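{- Let $M$ be a positive integer, write $R_M=\{0=r_1<r_2<\dots<r_{|R_M|}\}\subseteq\{0,\dots,M-1\}$ and set $r_{|R_M|+1}=M$. Then for every integer $\nu\ge0$, $$\sum_{\substack{2\le i\le |R_M|+1\\ 2^{\nu+1}\le r_i-r_{i-1}<2^{\nu+2}}}(r_i-r_{i-1})^2\le|N_M(2^\nu)|\,2^{\nu+4}.$$
   Context: $R_M=\{a^2:a\in\mathbb{Z}_M\}$, and $N_M(h)$ is the set of $x\in\mathbb{Z}_M$ such that all of $x,x+1,\dots,x+h-1$ are not in $R_M$. -}

module Defs where

open import Data.Nat using (ℕ; zero; suc; _+_; _*_; _∸_; _^_; _≤_; _<_; NonZero; _≡ᵇ_; _<ᵇ_; _≤ᵇ_)
open import Data.Nat.DivMod using (_%_)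
open import Data.Bool using (Bool; true; false; not; _∧_)
open import Data.List using (List; []; _∷_; _++_; [_]; upTo; filterᵇ; length; map)
open import Data.Bool.ListAction using (any; all)
open import Data.Nat.ListAction using (sum)

-- Elements of ℤ_M are represented by their residues 0,…,M-1.
-- isSqᵇ M x = true  iff  x ≡ a² (mod M) for some a ∈ {0,…,M-1}, i.e. x mod M ∈ R_M.
isSqᵇ : (M : ℕ) .{{_ : NonZero M}} → ℕ → Bool
isSqᵇ M x = any (λ a → ((a * a) % M) ≡ᵇ (x % M)) (upTo M)

R : (M : ℕ) .{{_ : NonZero M}} → List ℕ
R M = filterᵇ (isSqᵇ M) (upTo M)

gaps : List ℕ → List ℕ
gaps [] = []
gaps (x ∷ []) = []
gaps (x ∷ y ∷ xs) = (y ∸ x) ∷ gaps (y ∷ xs)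

Rgaps : (M : ℕ) .{{_ : NonZero M}} → List ℕ
Rgaps M = gaps (R M ++ [ M ])

-- N_M(h) = { x ∈ ℤ_M : x, x+1, …, x+h-1 ∉ R_M } (addition mod M)
N : (M : ℕ) .{{_ : NonZero M}} → ℕ → List ℕ
N M h = filterᵇ (λ x → all (λ j → not (isSqᵇ M ((x + j) % M))) (upTo h)) (upTo M)

gapSum : (M : ℕ) .{{_ : NonZero M}} → ℕ → ℕ
gapSum M ν = sum (map (λ d → d * d)
  (filterᵇ (λ d → (2 ^ (ν + 1) ≤ᵇ d) ∧ (d <ᵇ 2 ^ (ν + 2))) (Rgaps M)))

-- Put h = 2^ν. A gap d with 2h ≤ d < 4h satisfies d² ≤ 8h(d − h), so the sum is at most
-- 2^(ν+3) Σ (d ∸ h) over all gaps. If r < r' are consecutive in R_M ∪ {M}, each x with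
-- r < x ≤ r' − h starts a run x, …, x+h−1 of non-squares below M (so nothing wraps around),
-- i.e. x ∈ N_M(h); this gives d ∸ h elements of N_M(h) per gap, disjoint for distinct gaps.

module Submission where

open import Defs
open import Data.Nat
  using (ℕ; zero; suc; _+_; _*_; _∸_; _^_; _≤_; _<_; z≤n; s≤s; _≤ᵇ_; _<ᵇ_; NonZero; _≤?_)
open import Data.Nat.Properties
open import Data.Nat.DivMod using (_%_; m<n⇒m%n≡m)
open import Data.Nat.ListAction using (sum)
open import Data.Nat.Solver using (module +-*-Solver)
open import Data.Bool using (Bool; true; false; not; _∧_; T)
open import Data.Bool.Properties using (T-∧; T-not-≡)
open import Data.Bool.ListAction using (all)
open import Data.List using (List; []; _∷_; _++_; [_]; upTo; applyUpTo; filterᵇ; length; map)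
open import Data.List.Properties using (filter-++; filter-accept; length-++)
open import Data.List.Relation.Unary.All using (All; []; _∷_)
open import Data.List.Relation.Unary.All.Properties using (++⁺; ++⁻ˡ; applyUpTo⁻; applyUpTo⁺₁; all⁻)
open import Data.Product using (_,_)
open import Function using (_∘_; id)
open import Function.Bundles using (Equivalence)
open import Relation.Nullary using (yes; no)
open import Relation.Nullary.Decidable using (T?)
open import Relation.Binary.PropositionalEquality
  using (_≡_; refl; sym; trans; cong; cong₂; subst; module ≡-Reasoning)

range : ℕ → ℕ → List ℕ
range a zero    = []
range a (suc n) = a ∷ range (suc a) n

range-++ : ∀ a m n → range a (m + n) ≡ range a m ++ range (m + a) n
range-++ a zero    n = refl
range-++ a (suc m) n =
  cong (a ∷_) (trans (range-++ (suc a) m n) (cong (λ b → range (suc a) m ++ range b n) (+-suc m a)))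

range-∷ʳ : ∀ a n → range a (suc n) ≡ range a n ++ [ n + a ]
range-∷ʳ a n = trans (cong (range a) (+-comm 1 n)) (range-++ a n 1)

applyUpTo≡range : ∀ (f : ℕ → ℕ) a n → (∀ i → f i ≡ a + i) → applyUpTo f n ≡ range a n
applyUpTo≡range f a zero    f≗a+ = refl
applyUpTo≡range f a (suc n) f≗a+ =
  cong₂ _∷_ (trans (f≗a+ 0) (+-identityʳ a))
            (applyUpTo≡range (f ∘ suc) (suc a) n (λ i → trans (f≗a+ (suc i)) (+-suc a i)))

upTo≡range : ∀ n → upTo n ≡ range 0 n
upTo≡range n = applyUpTo≡range id 0 n (λ _ → refl)

module _ {P : ℕ → Set} where

  All-range⁻ : ∀ {a n j} → All P (range a n) → j < n → P (a + j)
  All-range⁻ {a} {n} ps = applyUpTo⁻ (a +_) n (subst (All P) (sym (applyUpTo≡range (a +_) a n (λ _ → refl))) ps)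

  All-range-prefix : ∀ {a m n} → m ≤ n → All P (range a n) → All P (range a m)
  All-range-prefix {a} {m} {n} m≤n ps =
    ++⁻ˡ (range a m) (subst (All P) (trans (cong (range a) (sym (m+[n∸m]≡n m≤n))) (range-++ a m (n ∸ m))) ps)

count : (ℕ → Bool) → List ℕ → ℕ
count p xs = length (filterᵇ p xs)

count-++ : ∀ p xs ys → count p (xs ++ ys) ≡ count p xs + count p ys
count-++ p xs ys = trans (cong length (filter-++ (T? ∘ p) xs ys)) (length-++ (filterᵇ p xs))

count-∷-accept : ∀ {p x} xs → T (p x) → count p (x ∷ xs) ≡ suc (count p xs)
count-∷-accept {p} xs px = cong length (filter-accept (T? ∘ p) px)

count≤count-∷ : ∀ p x xs → count p xs ≤ count p (x ∷ xs)
count≤count-∷ p x xs with p x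
... | true  = n≤1+n _
... | false = ≤-refl

sum-filterᵇ-≤ : ∀ (p : ℕ → Bool) (F G : ℕ → ℕ) c → (∀ d → T (p d) → F d ≤ c * G d) →
                ∀ ds → sum (map F (filterᵇ p ds)) ≤ c * sum (map G ds)
sum-filterᵇ-≤ p F G c F≤cG []       = z≤n
sum-filterᵇ-≤ p F G c F≤cG (d ∷ ds) with p d in pd
... | true  = begin
    F d + sum (map F (filterᵇ p ds))  ≤⟨ +-mono-≤ (F≤cG d (subst T (sym pd) _)) (sum-filterᵇ-≤ p F G c F≤cG ds) ⟩
    c * G d + c * sum (map G ds)      ≡⟨ *-distribˡ-+ c (G d) _ ⟨
    c * (G d + sum (map G ds))        ∎
  where open ≤-Reasoning
... | false = ≤-trans (sum-filterᵇ-≤ p F G c F≤cG ds) (*-monoʳ-≤ c (m≤n+m _ (G d)))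

square≤8h[d∸h] : ∀ h d → h * 2 ≤ d → d < h * 4 → d * d ≤ h * 8 * (d ∸ h)
square≤8h[d∸h] h d 2h≤d d<4h = begin
  d * d                      ≤⟨ *-mono-≤ d≤2e (<⇒≤ d<4h) ⟩
  (d ∸ h) * 2 * (h * 4)      ≡⟨ solve 2 (λ e h → e :* con 2 :* (h :* con 4) := h :* con 8 :* e) refl (d ∸ h) h ⟩
  h * 8 * (d ∸ h)            ∎
  where
  open ≤-Reasoning
  open +-*-Solver
  h+h≤d : h + h ≤ d
  h+h≤d = subst (_≤ d) (solve 1 (λ h → h :* con 2 := h :+ h) refl h) 2h≤d
  d≤2e : d ≤ (d ∸ h) * 2
  d≤2e = begin
    d                  ≡⟨ m+[n∸m]≡n (m+n≤o⇒m≤o h h+h≤d) ⟨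
    h + (d ∸ h)        ≤⟨ +-monoˡ-≤ (d ∸ h) (m+n≤o⇒m≤o∸n h h+h≤d) ⟩
    (d ∸ h) + (d ∸ h)  ≡⟨ solve 1 (λ e → e :+ e := e :* con 2) refl (d ∸ h) ⟩
    (d ∸ h) * 2        ∎

dyadic-square≤ : ∀ ν d → T ((2 ^ (ν + 1) ≤ᵇ d) ∧ (d <ᵇ 2 ^ (ν + 2))) → d * d ≤ 2 ^ (ν + 3) * (d ∸ 2 ^ ν)
dyadic-square≤ ν d inBand with Equivalence.to T-∧ inBand
... | lo , hi = subst (λ c → d * d ≤ c * (d ∸ 2 ^ ν)) (sym (^-distribˡ-+-* 2 ν 3))
  (square≤8h[d∸h] (2 ^ ν) d (subst (_≤ d) (^-distribˡ-+-* 2 ν 1) (≤ᵇ⇒≤ _ d lo))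
                            (subst (d <_) (^-distribˡ-+-* 2 ν 2) (<ᵇ⇒< d _ hi)))

excess : ℕ → List ℕ → ℕ
excess h ds = sum (map (_∸ h) ds)

Clear : (ℕ → Bool) → List ℕ → Set
Clear f = All (λ i → f i ≡ false)

module GapWindows (f : ℕ → Bool) (h : ℕ) (0<h : 0 < h) (W : ℕ → Bool) (size : ℕ)
  (window : ∀ {x} → h + x ≤ size → Clear f (range x h) → T (W x)) where

  clear-run-windows : ∀ {a} n → Clear f (range a n) → n + a ≤ size → suc n ∸ h ≤ count W (range a n)
  clear-run-windows zero _ _ = ≤-reflexive (m≤n⇒m∸n≡0 0<h)
  clear-run-windows {a} (suc n) clear@(_ ∷ rest) fits with h ≤? suc n
  ... | no  h≰ = ≤-trans (≤-reflexive (m≤n⇒m∸n≡0 (≰⇒> h≰))) z≤n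
  ... | yes h≤ = begin
    suc (suc n) ∸ h                   ≡⟨ +-∸-assoc 1 h≤ ⟩
    suc (suc n ∸ h)                   ≤⟨ s≤s (clear-run-windows n rest (subst (_≤ size) (sym (+-suc n a)) fits)) ⟩
    suc (count W (range (suc a) n))   ≡⟨ count-∷-accept (range (suc a) n) window-at-a ⟨
    count W (range a (suc n))         ∎
    where
    open ≤-Reasoning
    window-at-a : T (W a)
    window-at-a = window (≤-trans (+-monoˡ-≤ a h≤) fits) (All-range-prefix h≤ clear)

  clear-gap-windows : ∀ k s → Clear f (range (suc s) k) → k + suc s ≤ size →
                      (k + suc s ∸ s) ∸ h ≤ count W (range (suc s) k)
  clear-gap-windows k s clear fits =
    subst (λ d → d ∸ h ≤ count W (range (suc s) k)) (sym (trans (cong (_∸ s) (+-suc k s)) (m+n∸n≡m (suc k) s)))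
      (clear-run-windows k clear fits)

  -- Scanning invariant: s is the last marked point, the k points after it are clear,
  -- and the scan continues with the n points from k + suc s up to e.
  excess-gaps≤count-windows : ∀ n k s {e} → Clear f (range (suc s) k) → k + suc s + n ≡ e → e ≤ size →
    excess h (gaps (s ∷ filterᵇ f (range (k + suc s) n) ++ [ e ])) ≤ count W (range (suc s) (k + n))
  excess-gaps≤count-windows zero k s clear refl fits = begin
    (k + suc s + 0 ∸ s) ∸ h + 0        ≡⟨ +-identityʳ _ ⟩
    (k + suc s + 0 ∸ s) ∸ h            ≡⟨ cong (λ e → (e ∸ s) ∸ h) (+-identityʳ (k + suc s)) ⟩
    (k + suc s ∸ s) ∸ h                ≤⟨ clear-gap-windows k s clear (subst (_≤ size) (+-identityʳ _) fits) ⟩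
    count W (range (suc s) k)          ≡⟨ cong (count W ∘ range (suc s)) (+-identityʳ k) ⟨
    count W (range (suc s) (k + 0))    ∎
    where open ≤-Reasoning
  excess-gaps≤count-windows (suc n) k s {e} clear ends fits with f (k + suc s) in fp
  ... | false rewrite +-suc k n =
    excess-gaps≤count-windows n (suc k) s clear′ (trans (sym (+-suc (k + suc s) n)) ends) fits
    where
    clear′ : Clear f (range (suc s) (suc k))
    clear′ = subst (Clear f) (sym (range-∷ʳ (suc s) k)) (++⁺ clear (fp ∷ []))
  ... | true = begin
    (k + suc s ∸ s) ∸ h + excess h (gaps (k + suc s ∷ filterᵇ f (range (suc (k + suc s)) n) ++ [ e ]))
      ≤⟨ +-mono-≤ (clear-gap-windows k s clear (≤-trans (m≤m+n _ (suc n)) (subst (_≤ size) (sym ends) fits)))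
                  (excess-gaps≤count-windows n 0 (k + suc s) [] (trans (sym (+-suc (k + suc s) n)) ends) fits) ⟩
    count W (range (suc s) k) + count W (range (suc (k + suc s)) n)
      ≤⟨ +-monoʳ-≤ (count W (range (suc s) k)) (count≤count-∷ W (k + suc s) _) ⟩
    count W (range (suc s) k) + count W (range (k + suc s) (suc n))
      ≡⟨ count-++ W (range (suc s) k) _ ⟨
    count W (range (suc s) k ++ range (k + suc s) (suc n))
      ≡⟨ cong (count W) (range-++ (suc s) k (suc n)) ⟨
    count W (range (suc s) (k + suc n))
      ∎
    where open ≤-Reasoning

clear-window-mod : ∀ M .{{_ : NonZero M}} (p : ℕ → Bool) {h x} → h + x ≤ M → Clear p (range x h) →
                   T (all (λ j → not (p ((x + j) % M))) (upTo h))
clear-window-mod M p {h} {x} fits clear = all⁻ _ (applyUpTo⁺₁ id h clear-at)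
  where
  clear-at : ∀ {j} → j < h → T (not (p ((x + j) % M)))
  clear-at {j} j<h rewrite m<n⇒m%n≡m (≤-trans (+-monoʳ-< x j<h) (subst (_≤ M) (+-comm h x) fits)) =
    Equivalence.from T-not-≡ (All-range⁻ clear j<h)

lemma4p5 : (m ν : ℕ) → gapSum (suc m) ν ≤ length (N (suc m) (2 ^ ν)) * 2 ^ (ν + 4)
lemma4p5 m ν = begin
  gapSum M ν
    ≤⟨ sum-filterᵇ-≤ _ (λ d → d * d) (_∸ h) (2 ^ (ν + 3)) (dyadic-square≤ ν) (Rgaps M) ⟩
  2 ^ (ν + 3) * excess h (gaps (R M ++ [ M ]))
    -- r₁ = 0 appears because isSqᵇ M 0 computes to true (witness a = 0)
    ≡⟨ cong (λ xs → 2 ^ (ν + 3) * excess h (gaps (filterᵇ (isSqᵇ M) xs ++ [ M ]))) (upTo≡range M) ⟩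
  2 ^ (ν + 3) * excess h (gaps (0 ∷ filterᵇ (isSqᵇ M) (range 1 m) ++ [ M ]))
    ≤⟨ *-monoʳ-≤ (2 ^ (ν + 3)) (≤-trans (excess-gaps≤count-windows m 0 0 [] refl ≤-refl) (count≤count-∷ W 0 _)) ⟩
  2 ^ (ν + 3) * count W (range 0 M)
    ≡⟨ cong (λ xs → 2 ^ (ν + 3) * count W xs) (upTo≡range M) ⟨
  2 ^ (ν + 3) * length (N M h)
    ≤⟨ *-monoˡ-≤ (length (N M h)) (^-monoʳ-≤ 2 (+-monoʳ-≤ ν (n≤1+n 3))) ⟩
  2 ^ (ν + 4) * length (N M h)
    ≡⟨ *-comm (2 ^ (ν + 4)) _ ⟩
  length (N M h) * 2 ^ (ν + 4)
    ∎
  where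
  open ≤-Reasoning
  M : ℕ
  M = suc m
  h : ℕ
  h = 2 ^ ν
  W : ℕ → Bool
  W x = all (λ j → not (isSqᵇ M ((x + j) % M))) (upTo h)
  open GapWindows (isSqᵇ M) h (m^n>0 2 ν) W M (clear-window-mod M (isSqᵇ M))
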